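{- Let $\lambda\in\mathbb{C}$ with $\lambda\neq 1$, let $n\geq 1$ be an integer and $a\in\mathbb{Z}_+=\{0,1,2,\dots\}$. Then \[ (1-\lambda)^{ -an}\sum_{l=0}^{an}\binom{an}{l}(-\lambda)^{an-l}H_{n-1}^{(an)}(x+l\mid\lambda)=\sum_{l=0}^{n-1}\sum_{k=0}^{l}\frac{\binom{l}{k}}{\binom{k+n}{n}}S_1(n-1,l)\,S_2(k+n,n)\,(x-1)^{l-k}. \]
   Context: For $\lambda\in\mathbb{C}$, $\lambda\neq1$, and $\alpha\in\mathbb{R}$, the Frobenius–Euler polynomials of order $\alpha$ are defined by $\left(\frac{1-\lambda}{e^t-\lambda}\right)^{\alpha}e^{xt}=\sum_{n=0}^{\infty}H_n^{(\alpha)}(x\mid\lambda)\frac{t^n}{n!}$. The (signed) Stirling numbers of the first kind are defined by $(x)_n=x(x-1)\cdots(x-n+1)=\sum_{l=0}^{n}S_1(n,l)x^l$, and the Stirling numbers of the second kind by $(e^t-1)^n=n!\sum_{l=n}^{\infty}S_2(l,n)\frac{t^l}{l!}$. The convention $0^0=1$ is used. -}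

module Defs where

open import Level using (Level; _⊔_) renaming (suc to lsuc)
open import Algebra.Bundles using (CommutativeRing)
open import Data.Nat using (ℕ; zero; suc; _∸_; _!)
open import Data.Nat.Combinatorics using (_C_)
open import Data.Fin using (Fin; toℕ) renaming (zero to fzero; suc to fsuc)
open import Data.Vec using (Vec; []; _∷_; head; lookup)
open import Relation.Nullary using (¬_)

ℕ→R : ∀ {c ℓ} (R : CommutativeRing c ℓ) → ℕ → CommutativeRing.Carrier R
ℕ→R R zero = CommutativeRing.0# R
ℕ→R R (suc n) = CommutativeRing._+_ R (CommutativeRing.1# R) (ℕ→R R n)

-- A field of characteristic zero (the complex numbers are an instance).
-- The inverse is a total operation, only required to be a two-sided inverse on nonzero elements.
record CharZeroField c ℓ : Set (lsuc (c ⊔ ℓ)) where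
  field
    commutativeRing : CommutativeRing c ℓ
  open CommutativeRing commutativeRing public
  field
    _⁻¹ : Carrier → Carrier
    ⁻¹-inverse : ∀ x → ¬ (x ≈ 0#) → x * (x ⁻¹) ≈ 1#
    charZero : ∀ n → ¬ (ℕ→R commutativeRing (suc n) ≈ 0#)

module FE {c ℓ} (F : CharZeroField c ℓ) where
  open CharZeroField F
    using (Carrier; _+_; _*_; -_; _-_; 0#; 1#; _⁻¹; commutativeRing)

  ι : ℕ → Carrier
  ι = ℕ→R commutativeRing

  infixr 8 _^_
  _^_ : Carrier → ℕ → Carrier
  x ^ zero = 1#
  x ^ suc n = x * (x ^ n)

  Σ≤ : ℕ → (ℕ → Carrier) → Carrier
  Σ≤ zero f = f 0
  Σ≤ (suc n) f = Σ≤ n f + f (suc n)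

  ΣFin : ∀ {n} → (Fin n → Carrier) → Carrier
  ΣFin {zero} f = 0#
  ΣFin {suc n} f = f fzero + ΣFin (λ i → f (fsuc i))

  -- Formal power series, represented by their exponential coefficients:
  -- A ↔ Σ_m A m t^m / m!

  Series : Set c
  Series = ℕ → Carrier

  egfMul : Series → Series → Series
  egfMul A B m = Σ≤ m (λ j → ι (m C j) * (A j * B (m ∸ j)))

  oneS : Series
  oneS zero = 1#
  oneS (suc m) = 0#

  egfPow : Series → ℕ → Series
  egfPow A zero = oneS
  egfPow A (suc k) = egfMul A (egfPow A k)

  scaleS : Carrier → Series → Series
  scaleS c A m = c * A m

  expS : Carrier → Series
  expS x m = x ^ m

  expMinusConst : Carrier → Series
  expMinusConst c zero = 1# - c
  expMinusConst c (suc m) = 1#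

  -- reciprocal of a series whose constant term is invertible:
  -- B 0 = (A 0)⁻¹,  B m = - (A 0)⁻¹ Σ_{j=1}^{m} C(m,j) A j B (m-j).
  -- invVec A m lists B m, B (m-1), ..., B 0.
  invVec : Series → (m : ℕ) → Vec Carrier (suc m)
  invVec A zero = (A 0 ⁻¹) ∷ []
  invVec A (suc m) =
    (- ((A 0 ⁻¹) * ΣFin (λ (i : Fin (suc m)) →
        ι (suc m C suc (toℕ i)) * (A (suc (toℕ i)) * lookup (invVec A m) i))))
    ∷ invVec A m

  egfInv : Series → Series
  egfInv A m = head (invVec A m)

  -- Frobenius–Euler polynomials of (nonnegative integer) order α:
  -- ((1-λ)/(e^t-λ))^α e^{xt} = Σ_n H_n^{(α)}(x|λ) t^n/n!

  H : (n α : ℕ) → (x λ' : Carrier) → Carrier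
  H n α x λ' =
    egfMul (egfPow (scaleS (1# - λ') (egfInv (expMinusConst λ'))) α) (expS x) n

  -- Signed Stirling numbers of the first kind: (x)_n = Σ_l S₁(n,l) x^l.
  -- fallingCoeffs n l = coefficient of x^l in x(x-1)...(x-n+1),
  -- computed by multiplying the coefficient list by (x - n) at each step.
  fallingCoeffs : ℕ → ℕ → Carrier
  fallingCoeffs zero zero = 1#
  fallingCoeffs zero (suc l) = 0#
  fallingCoeffs (suc n) zero = - (ι n) * fallingCoeffs n zero
  fallingCoeffs (suc n) (suc l) = fallingCoeffs n l + (- (ι n)) * fallingCoeffs n (suc l)

  S₁ : ℕ → ℕ → Carrier
  S₁ = fallingCoeffs

  -- Stirling numbers of the second kind: (e^t - 1)^n = n! Σ_l S₂(l,n) t^l/l!.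
  S₂ : ℕ → ℕ → Carrier
  S₂ l n = (ι (n !)) ⁻¹ * egfPow (expMinusConst 1#) n l

module Submission where

-- Both sides of the identity are equal to x^(n-1); the proof is an exercise in
-- exponential generating functions (EGFs), Σ_m A_m t^m/m!.
--
-- With N = a·n, the binomial theorem turns
--   Σ_l C(N,l) (-λ)^(N-l) e^((x+l)t)   into   e^(xt) (e^t - λ)^N,
-- so the sum is the EGF ((1-λ)/(e^t-λ))^N (e^t-λ)^N e^(xt) = (1-λ)^N e^(xt);
-- after the factor (1-λ)^(-N) its (n-1)-st coefficient is x^(n-1).
--
-- Let τ = (e^t-1)/t and β = 1/τ = t/(e^t-1).  The quotient
-- S₂(k+n,n)/C(k+n,n) is the k-th coefficient of τ^n, so the inner sum is the
-- l-th coefficient of ψ = τ^n e^((x-1)t).  The key identity is that for EGFs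
--   Σ_l S₁(m,l) ψ_l = m-th coefficient of e^t β^(m+1) ψ,
-- proved by induction on m from the recurrence of S₁ and the differential
-- equation t β' = β - e^t β².  With m = n-1 the right side becomes the m-th
-- coefficient of e^t β^n τ^n e^((x-1)t) = e^(xt), i.e. x^m.

open import Algebra.Bundles using (CommutativeRing)
open import Data.Nat using (ℕ; zero; suc; _∸_; _≤_; _<_; z≤n; s≤s; _!; NonZero; ≢-nonZero⁻¹)
  renaming (_+_ to _+ℕ_; _*_ to _*ℕ_)
import Data.Nat.Properties as ℕP
open import Data.Nat.Combinatorics
  using (_C_; nCk+nC[k+1]≡[n+1]C[k+1]; k>n⇒nCk≡0; nCk≡nC[n∸k]; nCn≡1; nCk≡n!/k![n-k]!; k![n∸k]!∣n!)
open import Data.Nat.DivMod using (_/_; m/n*n≡m)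
open import Data.Nat.Properties using (_!≢0; _!*_!≢0)
open import Data.Fin using (Fin; toℕ) renaming (zero to fzero; suc to fsuc)
open import Data.Vec using (lookup)
open import Data.Product using (_,_)
open import Relation.Nullary using (¬_; contradiction)
open import Relation.Binary.PropositionalEquality as P using (_≡_)
import Algebra.Solver.Ring.NaturalCoefficients.Default as NaturalSolver
open import Defs

nC0≡1 : ∀ n → n C 0 ≡ 1
nC0≡1 n = P.trans (nCk≡nC[n∸k] {0} {n} z≤n) (nCn≡1 n)

C[k+n,n]*n!*k!≡[k+n]! : ∀ k n → ((k +ℕ n) C n) *ℕ n ! *ℕ k ! ≡ (k +ℕ n) !
C[k+n,n]*n!*k!≡[k+n]! k n = begin
  ((k +ℕ n) C n) *ℕ n ! *ℕ k !                   ≡⟨ ℕP.*-assoc ((k +ℕ n) C n) (n !) (k !) ⟩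
  ((k +ℕ n) C n) *ℕ (n ! *ℕ k !)                 ≡⟨ P.cong (λ z → ((k +ℕ n) C n) *ℕ (n ! *ℕ z !)) (P.sym (ℕP.m+n∸n≡m k n)) ⟩
  ((k +ℕ n) C n) *ℕ (n ! *ℕ ((k +ℕ n) ∸ n) !)    ≡⟨ P.cong (_*ℕ (n ! *ℕ ((k +ℕ n) ∸ n) !)) (nCk≡n!/k![n-k]! n≤k+n) ⟩
  (((k +ℕ n) ! / (n ! *ℕ ((k +ℕ n) ∸ n) !)) {{n !* ((k +ℕ n) ∸ n) !≢0}}) *ℕ (n ! *ℕ ((k +ℕ n) ∸ n) !)
                                                 ≡⟨ m/n*n≡m {{n !* ((k +ℕ n) ∸ n) !≢0}} (k![n∸k]!∣n! n≤k+n) ⟩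
  (k +ℕ n) !                                     ∎
  where
  open P.≡-Reasoning
  n≤k+n : n ≤ k +ℕ n
  n≤k+n = ℕP.m≤n+m n k

-- Finite sums Σ_{i=0}^{n}, the image of ℕ, powers and the binomial theorem in an
-- arbitrary commutative ring.  It is instantiated both at the base field and at
-- the ring of EGFs.
module RingSums {c ℓ} (R : CommutativeRing c ℓ) where
  open CommutativeRing R public
  open import Relation.Binary.Reasoning.Setoid setoid public
  open import Algebra.Properties.CommutativeSemiring.Exp commutativeSemiring public
    using (_^_; ^-congˡ; ^-distrib-*)
  open import Algebra.Properties.Semiring.Mult semiring using (_×_; ×-homo-+; ×1-homo-*)
  open NaturalSolver commutativeSemiring public using (solve; _:=_; _:+_; _:*_; con)

  1^ : ∀ n → 1# ^ n ≈ 1#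
  1^ zero = refl
  1^ (suc n) = trans (*-identityˡ _) (1^ n)

  ι : ℕ → Carrier
  ι = ℕ→R R

  -- ι n is the n-fold sum of 1#, hence a semiring homomorphism ℕ → R.
  ι≈×1 : ∀ n → ι n ≈ n × 1#
  ι≈×1 zero = refl
  ι≈×1 (suc n) = +-congˡ (ι≈×1 n)

  ι-+ : ∀ a b → ι (a +ℕ b) ≈ ι a + ι b
  ι-+ a b = trans (ι≈×1 (a +ℕ b)) (trans (×-homo-+ 1# a b) (sym (+-cong (ι≈×1 a) (ι≈×1 b))))

  ι-* : ∀ a b → ι (a *ℕ b) ≈ ι a * ι b
  ι-* a b = trans (ι≈×1 (a *ℕ b)) (trans (×1-homo-* a b) (sym (*-cong (ι≈×1 a) (ι≈×1 b))))

  Σ : ℕ → (ℕ → Carrier) → Carrier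
  Σ zero f = f 0
  Σ (suc n) f = Σ n f + f (suc n)

  Σ-cong : ∀ n {f g} → (∀ j → j ≤ n → f j ≈ g j) → Σ n f ≈ Σ n g
  Σ-cong zero f≈g = f≈g 0 z≤n
  Σ-cong (suc n) f≈g =
    +-cong (Σ-cong n (λ j j≤n → f≈g j (ℕP.m≤n⇒m≤1+n j≤n))) (f≈g (suc n) ℕP.≤-refl)

  Σ-cong′ : ∀ n {f g} → (∀ j → f j ≈ g j) → Σ n f ≈ Σ n g
  Σ-cong′ n f≈g = Σ-cong n (λ j _ → f≈g j)

  Σ-+ : ∀ n f g → Σ n (λ j → f j + g j) ≈ Σ n f + Σ n g
  Σ-+ zero f g = refl
  Σ-+ (suc n) f g = trans (+-congʳ (Σ-+ n f g))
    (solve 4 (λ a b d e → ((a :+ b) :+ (d :+ e)) := ((a :+ d) :+ (b :+ e))) refl _ _ _ _)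

  Σ-*ˡ : ∀ n a f → a * Σ n f ≈ Σ n (λ j → a * f j)
  Σ-*ˡ zero a f = refl
  Σ-*ˡ (suc n) a f = trans (distribˡ _ _ _) (+-congʳ (Σ-*ˡ n a f))

  Σ-0 : ∀ n {f} → (∀ j → f j ≈ 0#) → Σ n f ≈ 0#
  Σ-0 zero f≈0 = f≈0 0
  Σ-0 (suc n) f≈0 = trans (+-cong (Σ-0 n f≈0) (f≈0 (suc n))) (+-identityˡ _)

  Σ-head : ∀ n f → Σ (suc n) f ≈ f 0 + Σ n (λ j → f (suc j))
  Σ-head zero f = refl
  Σ-head (suc n) f = trans (+-congʳ (Σ-head n f)) (+-assoc _ _ _)

  -- Pascal's rule C(m+1,j) = C(m,j-1) + C(m,j) applied inside a binomial sum:
  -- the common step of the binomial theorem and of the Leibniz rule for EGFs.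
  Σ-pascal : ∀ m (u : ℕ → ℕ → Carrier) →
    Σ (suc m) (λ j → ι (suc m C j) * u j (suc m ∸ j))
      ≈ Σ m (λ j → ι (m C j) * u (suc j) (m ∸ j)) + Σ m (λ j → ι (m C j) * u j (suc (m ∸ j)))
  Σ-pascal m u = begin
    Σ (suc m) (λ j → ι (suc m C j) * u j (suc m ∸ j))
      ≈⟨ Σ-head m _ ⟩
    ι (suc m C 0) * u 0 (suc m) + Σ m (λ j → ι (suc m C suc j) * u (suc j) (m ∸ j))
      ≈⟨ +-congˡ (Σ-cong′ m (λ j → trans (*-congʳ (pascal-rule j)) (distribʳ _ _ _))) ⟩
    ι (suc m C 0) * u 0 (suc m)
      + Σ m (λ j → ι (m C j) * u (suc j) (m ∸ j) + ι (m C suc j) * u (suc j) (m ∸ j))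
      ≈⟨ +-congˡ (Σ-+ m _ _) ⟩
    ι (suc m C 0) * u 0 (suc m) + (X + Y)
      ≈⟨ solve 3 (λ a x y → (a :+ (x :+ y)) := (x :+ (a :+ y))) refl _ X Y ⟩
    X + (ι (suc m C 0) * u 0 (suc m) + Y)
      ≈⟨ +-congˡ (+-congʳ (*-congʳ (reflexive (P.cong ι (P.trans (nC0≡1 (suc m)) (P.sym (nC0≡1 m))))))) ⟩
    X + (ι (m C 0) * u 0 (suc m) + Y)
      ≈⟨ +-congˡ (sym (Σ-head m h)) ⟩
    X + (Σ m h + h (suc m))
      ≈⟨ +-congˡ (+-cong (Σ-cong m (λ j j≤m → *-congˡ (reflexive (P.cong (u j) (ℕP.+-∸-assoc 1 j≤m)))))
                         last-vanishes) ⟩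
    X + (Σ m (λ j → ι (m C j) * u j (suc (m ∸ j))) + 0#)
      ≈⟨ +-congˡ (+-identityʳ _) ⟩
    X + Σ m (λ j → ι (m C j) * u j (suc (m ∸ j))) ∎
    where
    X = Σ m (λ j → ι (m C j) * u (suc j) (m ∸ j))
    Y = Σ m (λ j → ι (m C suc j) * u (suc j) (m ∸ j))
    h = λ j → ι (m C j) * u j (suc m ∸ j)
    pascal-rule : ∀ j → ι (suc m C suc j) ≈ ι (m C j) + ι (m C suc j)
    pascal-rule j = trans (reflexive (P.cong ι (P.sym (nCk+nC[k+1]≡[n+1]C[k+1] m j)))) (ι-+ (m C j) (m C suc j))
    last-vanishes : h (suc m) ≈ 0#
    last-vanishes = trans (*-congʳ (reflexive (P.cong ι (k>n⇒nCk≡0 (ℕP.n<1+n m))))) (zeroˡ _)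

  binomial : ∀ N a b → (a + b) ^ N ≈ Σ N (λ l → ι (N C l) * (a ^ l * b ^ (N ∸ l)))
  binomial zero a b =
    sym (trans (*-congˡ (*-identityˡ _)) (trans (*-congʳ (+-identityʳ _)) (*-identityˡ _)))
  binomial (suc N) a b = begin
    (a + b) * (a + b) ^ N ≈⟨ *-congˡ (binomial N a b) ⟩
    (a + b) * Σ N F ≈⟨ distribʳ _ _ _ ⟩
    a * Σ N F + b * Σ N F ≈⟨ +-cong (Σ-*ˡ N a F) (Σ-*ˡ N b F) ⟩
    Σ N (λ l → a * F l) + Σ N (λ l → b * F l)
      ≈⟨ +-cong (Σ-cong′ N (λ l → solve 4 (λ a c x y → (a :* (c :* (x :* y))) := (c :* ((a :* x) :* y))) refl a _ _ _))
                (Σ-cong′ N (λ l → solve 4 (λ b c x y → (b :* (c :* (x :* y))) := (c :* (x :* (b :* y)))) refl b _ _ _)) ⟩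
    Σ N (λ l → ι (N C l) * (a ^ suc l * b ^ (N ∸ l))) + Σ N (λ l → ι (N C l) * (a ^ l * b ^ suc (N ∸ l)))
      ≈⟨ sym (Σ-pascal N (λ j k → a ^ j * b ^ k)) ⟩
    Σ (suc N) (λ l → ι (suc N C l) * (a ^ l * b ^ (suc N ∸ l))) ∎
    where F = λ l → ι (N C l) * (a ^ l * b ^ (N ∸ l))

-- The ring of exponential generating functions over a commutative ring: a series
-- A is its coefficient sequence, A ↔ Σ_m A m t^m/m!, multiplied by the binomial
-- convolution.
module EGF {c ℓ} (R : CommutativeRing c ℓ) where
  open RingSums R public

  Series : Set c
  Series = ℕ → Carrier

  infix 4 _≋_
  _≋_ : Series → Series → Set ℓ
  A ≋ B = ∀ m → A m ≈ B m

  infixl 7 _⊛_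
  infixl 6 _⊞_
  _⊛_ : Series → Series → Series
  (A ⊛ B) m = Σ m (λ j → ι (m C j) * (A j * B (m ∸ j)))

  _⊞_ : Series → Series → Series
  (A ⊞ B) m = A m + B m

  ⊟_ : Series → Series
  (⊟ A) m = - A m

  0ₛ : Series
  0ₛ m = 0#

  1ₛ : Series
  1ₛ zero = 1#
  1ₛ (suc m) = 0#

  -- the derivative d/dt shifts exponential coefficients
  D : Series → Series
  D A m = A (suc m)

  ⊛-coeff₀ : ∀ A B → (A ⊛ B) 0 ≈ A 0 * B 0
  ⊛-coeff₀ A B = trans (*-congʳ (+-identityʳ _)) (*-identityˡ _)

  -- The Leibniz rule D(AB) = (DA)B + A(DB): every ring law below is proved by
  -- induction on the coefficient index through it.
  leibniz : ∀ A B m → (A ⊛ B) (suc m) ≈ (D A ⊛ B) m + (A ⊛ D B) m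
  leibniz A B m = Σ-pascal m (λ j k → A j * B k)

  ⊛-cong : ∀ {A A′ B B′} → A ≋ A′ → B ≋ B′ → A ⊛ B ≋ A′ ⊛ B′
  ⊛-cong A≋A′ B≋B′ m = Σ-cong′ m (λ j → *-congˡ (*-cong (A≋A′ j) (B≋B′ (m ∸ j))))

  ⊛-congˡ : ∀ {A A′} B → A ≋ A′ → A ⊛ B ≋ A′ ⊛ B
  ⊛-congˡ B A≋A′ = ⊛-cong {B = B} A≋A′ (λ _ → refl)

  ⊛-congʳ : ∀ A {B B′} → B ≋ B′ → A ⊛ B ≋ A ⊛ B′
  ⊛-congʳ A B≋B′ = ⊛-cong {A = A} (λ _ → refl) B≋B′

  ⊛-comm : ∀ A B → A ⊛ B ≋ B ⊛ A
  ⊛-comm A B zero = trans (⊛-coeff₀ A B) (trans (*-comm _ _) (sym (⊛-coeff₀ B A)))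
  ⊛-comm A B (suc m) = begin
    (A ⊛ B) (suc m)                 ≈⟨ leibniz A B m ⟩
    (D A ⊛ B) m + (A ⊛ D B) m       ≈⟨ +-cong (⊛-comm (D A) B m) (⊛-comm A (D B) m) ⟩
    (B ⊛ D A) m + (D B ⊛ A) m       ≈⟨ +-comm _ _ ⟩
    (D B ⊛ A) m + (B ⊛ D A) m       ≈⟨ sym (leibniz B A m) ⟩
    (B ⊛ A) (suc m)                 ∎

  ⊛-distribˡ : ∀ A B E → A ⊛ (B ⊞ E) ≋ A ⊛ B ⊞ A ⊛ E
  ⊛-distribˡ A B E zero =
    trans (⊛-coeff₀ A (B ⊞ E)) (trans (distribˡ _ _ _) (sym (+-cong (⊛-coeff₀ A B) (⊛-coeff₀ A E))))
  ⊛-distribˡ A B E (suc m) = begin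
    (A ⊛ (B ⊞ E)) (suc m)
      ≈⟨ leibniz A (B ⊞ E) m ⟩
    (D A ⊛ (B ⊞ E)) m + (A ⊛ (D B ⊞ D E)) m
      ≈⟨ +-cong (⊛-distribˡ (D A) B E m) (⊛-distribˡ A (D B) (D E) m) ⟩
    ((D A ⊛ B) m + (D A ⊛ E) m) + ((A ⊛ D B) m + (A ⊛ D E) m)
      ≈⟨ solve 4 (λ a b d e → ((a :+ b) :+ (d :+ e)) := ((a :+ d) :+ (b :+ e))) refl _ _ _ _ ⟩
    ((D A ⊛ B) m + (A ⊛ D B) m) + ((D A ⊛ E) m + (A ⊛ D E) m)
      ≈⟨ sym (+-cong (leibniz A B m) (leibniz A E m)) ⟩
    (A ⊛ B ⊞ A ⊛ E) (suc m) ∎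

  ⊛-distribʳ : ∀ A B E → (B ⊞ E) ⊛ A ≋ B ⊛ A ⊞ E ⊛ A
  ⊛-distribʳ A B E m =
    trans (⊛-comm (B ⊞ E) A m) (trans (⊛-distribˡ A B E m) (+-cong (⊛-comm A B m) (⊛-comm A E m)))

  ⊛-zeroˡ : ∀ A → 0ₛ ⊛ A ≋ 0ₛ
  ⊛-zeroˡ A m = Σ-0 m (λ j → trans (*-congˡ (zeroˡ _)) (zeroʳ _))

  ⊛-identityˡ : ∀ A → 1ₛ ⊛ A ≋ A
  ⊛-identityˡ A zero = trans (⊛-coeff₀ 1ₛ A) (*-identityˡ _)
  ⊛-identityˡ A (suc m) =
    trans (leibniz 1ₛ A m) (trans (+-cong (⊛-zeroˡ A m) (⊛-identityˡ (D A) m)) (+-identityˡ _))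

  ⊛-identityʳ : ∀ A → A ⊛ 1ₛ ≋ A
  ⊛-identityʳ A m = trans (⊛-comm A 1ₛ m) (⊛-identityˡ A m)

  ⊛-assoc : ∀ A B E → (A ⊛ B) ⊛ E ≋ A ⊛ (B ⊛ E)
  ⊛-assoc A B E zero = begin
    ((A ⊛ B) ⊛ E) 0   ≈⟨ trans (⊛-coeff₀ (A ⊛ B) E) (*-congʳ (⊛-coeff₀ A B)) ⟩
    (A 0 * B 0) * E 0 ≈⟨ *-assoc _ _ _ ⟩
    A 0 * (B 0 * E 0) ≈⟨ sym (trans (⊛-coeff₀ A (B ⊛ E)) (*-congˡ (⊛-coeff₀ B E))) ⟩
    (A ⊛ (B ⊛ E)) 0   ∎
  ⊛-assoc A B E (suc m) = begin
    ((A ⊛ B) ⊛ E) (suc m)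
      ≈⟨ leibniz (A ⊛ B) E m ⟩
    (D (A ⊛ B) ⊛ E) m + ((A ⊛ B) ⊛ D E) m
      ≈⟨ +-congʳ (⊛-congˡ E (leibniz A B) m) ⟩
    ((D A ⊛ B ⊞ A ⊛ D B) ⊛ E) m + ((A ⊛ B) ⊛ D E) m
      ≈⟨ +-congʳ (⊛-distribʳ E (D A ⊛ B) (A ⊛ D B) m) ⟩
    (((D A ⊛ B) ⊛ E) m + ((A ⊛ D B) ⊛ E) m) + ((A ⊛ B) ⊛ D E) m
      ≈⟨ +-cong (+-cong (⊛-assoc (D A) B E m) (⊛-assoc A (D B) E m)) (⊛-assoc A B (D E) m) ⟩
    ((D A ⊛ (B ⊛ E)) m + (A ⊛ (D B ⊛ E)) m) + (A ⊛ (B ⊛ D E)) m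
      ≈⟨ +-assoc _ _ _ ⟩
    (D A ⊛ (B ⊛ E)) m + ((A ⊛ (D B ⊛ E)) m + (A ⊛ (B ⊛ D E)) m)
      ≈⟨ +-congˡ (sym (⊛-distribˡ A (D B ⊛ E) (B ⊛ D E) m)) ⟩
    (D A ⊛ (B ⊛ E)) m + (A ⊛ (D B ⊛ E ⊞ B ⊛ D E)) m
      ≈⟨ +-congˡ (⊛-congʳ A (λ k → sym (leibniz B E k)) m) ⟩
    (D A ⊛ (B ⊛ E)) m + (A ⊛ D (B ⊛ E)) m
      ≈⟨ sym (leibniz A (B ⊛ E) m) ⟩
    (A ⊛ (B ⊛ E)) (suc m) ∎

  EGFRing : CommutativeRing c ℓ
  EGFRing = record
    { Carrier = Series ; _≈_ = _≋_ ; _+_ = _⊞_ ; _*_ = _⊛_ ; -_ = ⊟_ ; 0# = 0ₛ ; 1# = 1ₛ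
    ; isCommutativeRing = record
      { isRing = record
        { +-isAbelianGroup = record
          { isGroup = record
            { isMonoid = record
              { isSemigroup = record
                { isMagma = record
                  { isEquivalence = record
                    { refl = λ _ → refl ; sym = λ p m → sym (p m) ; trans = λ p q m → trans (p m) (q m) }
                  ; ∙-cong = λ p q m → +-cong (p m) (q m) }
                ; assoc = λ A B E m → +-assoc (A m) (B m) (E m) }
              ; identity = (λ A m → +-identityˡ (A m)) , (λ A m → +-identityʳ (A m)) }
            ; inverse = (λ A m → -‿inverseˡ (A m)) , (λ A m → -‿inverseʳ (A m))
            ; ⁻¹-cong = λ p m → -‿cong (p m) }
          ; comm = λ A B m → +-comm (A m) (B m) }
        ; *-cong = ⊛-cong
        ; *-assoc = ⊛-assoc
        ; *-identity = ⊛-identityˡ , ⊛-identityʳ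
        ; distrib = ⊛-distribˡ , ⊛-distribʳ }
      ; *-comm = ⊛-comm } }

  module 𝕊 = RingSums EGFRing
  open 𝕊 public using ()
    renaming (_:*_ to _⊗_; _:+_ to _⊕_; _:=_ to _≔_; solve to solveₛ; con to conₛ)

  scale : Carrier → Series → Series
  scale a A m = a * A m

  const : Carrier → Series
  const a = scale a 1ₛ

  expₛ : Carrier → Series
  expₛ a m = a ^ m

  eᵗ : Series
  eᵗ = expₛ 1#

  tₛ : Series
  tₛ zero = 0#
  tₛ (suc zero) = 1#
  tₛ (suc (suc m)) = 0#

  scale-⊛ : ∀ a A B → scale a A ⊛ B ≋ scale a (A ⊛ B)
  scale-⊛ a A B m = trans
    (Σ-cong′ m (λ j → solve 4 (λ c a x y → (c :* ((a :* x) :* y)) := (a :* (c :* (x :* y)))) refl _ a _ _))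
    (sym (Σ-*ˡ m a _))

  ⊛-scale : ∀ a A B → A ⊛ scale a B ≋ scale a (A ⊛ B)
  ⊛-scale a A B m = trans (⊛-comm A (scale a B) m) (trans (scale-⊛ a B A m) (*-congˡ (⊛-comm B A m)))

  const-⊛ : ∀ a B → const a ⊛ B ≋ scale a B
  const-⊛ a B m = trans (scale-⊛ a 1ₛ B m) (*-congˡ (⊛-identityˡ B m))

  const-^ : ∀ a n → const a 𝕊.^ n ≋ const (a ^ n)
  const-^ a zero zero = sym (*-identityˡ _)
  const-^ a zero (suc m) = sym (zeroʳ _)
  const-^ a (suc n) m =
    trans (⊛-congʳ (const a) (const-^ a n) m) (trans (const-⊛ a (const (a ^ n)) m) (sym (*-assoc _ _ _)))

  𝕊ι≋const : ∀ n → 𝕊.ι n ≋ const (ι n)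
  𝕊ι≋const zero m = sym (zeroˡ _)
  𝕊ι≋const (suc n) m = trans (+-cong (sym (*-identityˡ _)) (𝕊ι≋const n m)) (sym (distribʳ _ _ _))

  𝕊ι-⊛ : ∀ n A m → (𝕊.ι n ⊛ A) m ≈ ι n * A m
  𝕊ι-⊛ n A m = trans (⊛-congˡ A (𝕊ι≋const n) m) (const-⊛ (ι n) A m)

  expₛ-⊛ : ∀ a b → expₛ a ⊛ expₛ b ≋ expₛ (a + b)
  expₛ-⊛ a b m = sym (binomial m a b)

  eᵗ-^ : ∀ l → eᵗ 𝕊.^ l ≋ expₛ (ι l)
  eᵗ-^ zero zero = refl
  eᵗ-^ zero (suc m) = sym (zeroˡ _)
  eᵗ-^ (suc l) m = trans (⊛-congʳ eᵗ (eᵗ-^ l) m) (expₛ-⊛ 1# (ι l) m)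

  Σ-coeff : ∀ n (Fs : ℕ → Series) m → 𝕊.Σ n Fs m ≈ Σ n (λ l → Fs l m)
  Σ-coeff zero Fs m = refl
  Σ-coeff (suc n) Fs m = +-congʳ (Σ-coeff n Fs m)

  Dt≋1 : D tₛ ≋ 1ₛ
  Dt≋1 zero = refl
  Dt≋1 (suc m) = refl

  t-coeff₀ : ∀ A → (tₛ ⊛ A) 0 ≈ 0#
  t-coeff₀ A = trans (⊛-coeff₀ tₛ A) (zeroˡ _)

  t-coeffₛ : ∀ k A → (tₛ ⊛ A) (suc k) ≈ ι (suc k) * A k
  t-coeffₛ zero A = begin
    (tₛ ⊛ A) 1                     ≈⟨ leibniz tₛ A 0 ⟩
    (D tₛ ⊛ A) 0 + (tₛ ⊛ D A) 0    ≈⟨ +-cong (trans (⊛-congˡ A Dt≋1 0) (⊛-identityˡ A 0)) (t-coeff₀ (D A)) ⟩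
    A 0 + 0#                       ≈⟨ +-identityʳ _ ⟩
    A 0                            ≈⟨ sym (trans (*-congʳ (+-identityʳ _)) (*-identityˡ _)) ⟩
    ι 1 * A 0                      ∎
  t-coeffₛ (suc k) A = begin
    (tₛ ⊛ A) (suc (suc k))                     ≈⟨ leibniz tₛ A (suc k) ⟩
    (D tₛ ⊛ A) (suc k) + (tₛ ⊛ D A) (suc k)    ≈⟨ +-cong (trans (⊛-congˡ A Dt≋1 (suc k)) (⊛-identityˡ A (suc k)))
                                                         (t-coeffₛ k (D A)) ⟩
    A (suc k) + ι (suc k) * A (suc k)          ≈⟨ sym (trans (distribʳ _ _ _) (+-congʳ (*-identityˡ _))) ⟩
    ι (suc (suc k)) * A (suc k)                ∎

module FieldFacts {c ℓ} (F : CharZeroField c ℓ) where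
  open CharZeroField F public using (_⁻¹; ⁻¹-inverse)
  open CharZeroField F using (charZero; commutativeRing)
  open EGF commutativeRing public
  module FEF = FE F

  ⁻¹-inverseˡ : ∀ {z} → ¬ z ≈ 0# → z ⁻¹ * z ≈ 1#
  ⁻¹-inverseˡ {z} z≉0 = trans (*-comm _ _) (⁻¹-inverse z z≉0)

  ⁻¹-nonzero : ∀ {z} → ¬ z ≈ 0# → ¬ z ⁻¹ ≈ 0#
  ⁻¹-nonzero {z} z≉0 z⁻¹≈0 = z≉0 (begin
    z                ≈⟨ sym (*-identityʳ z) ⟩
    z * 1#           ≈⟨ *-congˡ (sym (⁻¹-inverse z z≉0)) ⟩
    z * (z * z ⁻¹)   ≈⟨ *-congˡ (*-congˡ z⁻¹≈0) ⟩
    z * (z * 0#)     ≈⟨ trans (*-congˡ (zeroʳ z)) (zeroʳ z) ⟩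
    0#               ∎)

  *-cancelˡ : ∀ {a x y} → ¬ a ≈ 0# → a * x ≈ a * y → x ≈ y
  *-cancelˡ {a} {x} {y} a≉0 ax≈ay = begin
    x                ≈⟨ sym (trans (*-congʳ (⁻¹-inverseˡ a≉0)) (*-identityˡ x)) ⟩
    (a ⁻¹ * a) * x   ≈⟨ *-assoc _ _ _ ⟩
    a ⁻¹ * (a * x)   ≈⟨ *-congˡ ax≈ay ⟩
    a ⁻¹ * (a * y)   ≈⟨ sym (*-assoc _ _ _) ⟩
    (a ⁻¹ * a) * y   ≈⟨ trans (*-congʳ (⁻¹-inverseˡ a≉0)) (*-identityˡ y) ⟩
    y                ∎

  ι-nonzero : ∀ n → .{{NonZero n}} → ¬ ι n ≈ 0#
  ι-nonzero zero {{n≢0}} = contradiction P.refl (≢-nonZero⁻¹ 0 {{n≢0}})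
  ι-nonzero (suc n) = charZero n

  Σ≤≈Σ : ∀ n {f g} → (∀ j → f j ≈ g j) → FEF.Σ≤ n f ≈ Σ n g
  Σ≤≈Σ zero f≈g = f≈g 0
  Σ≤≈Σ (suc n) f≈g = +-cong (Σ≤≈Σ n f≈g) (f≈g (suc n))

  ^≈^ : ∀ x n → x FEF.^ n ≈ x ^ n
  ^≈^ x zero = refl
  ^≈^ x (suc n) = *-congˡ (^≈^ x n)

  egfMul≋⊛ : ∀ A B → FEF.egfMul A B ≋ A ⊛ B
  egfMul≋⊛ A B m = Σ≤≈Σ m (λ j → refl)

  egfPow≋^ : ∀ A k → FEF.egfPow A k ≋ A 𝕊.^ k
  egfPow≋^ A zero zero = refl
  egfPow≋^ A zero (suc m) = refl
  egfPow≋^ A (suc k) m = trans (egfMul≋⊛ A (FEF.egfPow A k) m) (⊛-congʳ A (egfPow≋^ A k) m)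

  ΣFin≈Σ : ∀ m (f : Fin (suc m) → Carrier) (g : ℕ → Carrier) →
           (∀ i → f i ≈ g (toℕ i)) → FEF.ΣFin f ≈ Σ m g
  ΣFin≈Σ zero f g f≈g = trans (+-identityʳ _) (f≈g fzero)
  ΣFin≈Σ (suc m) f g f≈g =
    trans (+-cong (f≈g fzero) (ΣFin≈Σ m (λ i → f (fsuc i)) (λ j → g (suc j)) (λ i → f≈g (fsuc i))))
          (sym (Σ-head m g))

  lookup-invVec : ∀ A m (i : Fin (suc m)) → lookup (FEF.invVec A m) i ≡ FEF.egfInv A (m ∸ toℕ i)
  lookup-invVec A zero fzero = P.refl
  lookup-invVec A (suc m) fzero = P.refl
  lookup-invVec A (suc m) (fsuc i) = lookup-invVec A m i

  egfInv-inverse : ∀ A → ¬ A 0 ≈ 0# → A ⊛ FEF.egfInv A ≋ 1ₛ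
  egfInv-inverse A A₀≉0 zero = trans (⊛-coeff₀ A (FEF.egfInv A)) (⁻¹-inverse (A 0) A₀≉0)
  egfInv-inverse A A₀≉0 (suc m) = begin
    (A ⊛ B) (suc m)                        ≈⟨ Σ-head m _ ⟩
    ι (suc m C 0) * (A 0 * B (suc m)) + S  ≈⟨ +-congʳ (trans (*-congʳ C0≈1) (*-identityˡ _)) ⟩
    A 0 * B (suc m) + S                    ≈⟨ +-congʳ (*-congˡ (-‿cong (*-congˡ recursion-sum))) ⟩
    A 0 * (- (A 0 ⁻¹ * S)) + S             ≈⟨ +-congʳ (trans (sym (-‿distribʳ-* _ _)) (-‿cong cancel)) ⟩
    - S + S                                ≈⟨ -‿inverseˡ _ ⟩
    0#                                     ∎
    where
    open import Algebra.Properties.Ring ring using (-‿distribʳ-*)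
    B = FEF.egfInv A
    S = Σ m (λ j → ι (suc m C suc j) * (A (suc j) * B (m ∸ j)))
    C0≈1 : ι (suc m C 0) ≈ 1#
    C0≈1 = trans (reflexive (P.cong ι (nC0≡1 (suc m)))) (+-identityʳ _)
    recursion-sum : FEF.ΣFin (λ (i : Fin (suc m)) →
                      ι (suc m C suc (toℕ i)) * (A (suc (toℕ i)) * lookup (FEF.invVec A m) i)) ≈ S
    recursion-sum = ΣFin≈Σ m _ _ (λ i → *-congˡ (*-congˡ (reflexive (lookup-invVec A m i))))
    cancel : A 0 * (A 0 ⁻¹ * S) ≈ S
    cancel = trans (sym (*-assoc _ _ _)) (trans (*-congʳ (⁻¹-inverse (A 0) A₀≉0)) (*-identityˡ _))

module LeftSide {c ℓ} (F : CharZeroField c ℓ) (λ' : CharZeroField.Carrier F)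
                (λ'≉1 : ¬ CharZeroField._≈_ F λ' (CharZeroField.1# F)) where
  open FieldFacts F

  1-λ≉0 : ¬ 1# - λ' ≈ 0#
  1-λ≉0 1-λ≈0 = λ'≉1 (begin
    λ'                 ≈⟨ sym (+-identityʳ _) ⟩
    λ' + 0#            ≈⟨ +-congˡ (sym 1-λ≈0) ⟩
    λ' + (1# - λ')     ≈⟨ +-congˡ (+-comm _ _) ⟩
    λ' + (- λ' + 1#)   ≈⟨ sym (+-assoc _ _ _) ⟩
    (λ' - λ') + 1#     ≈⟨ trans (+-congʳ (-‿inverseʳ _)) (+-identityˡ _) ⟩
    1#                 ∎)

  Eλ : Series
  Eλ = eᵗ ⊞ const (- λ')

  expMinusConst≋Eλ : FEF.expMinusConst λ' ≋ Eλ
  expMinusConst≋Eλ zero = +-congˡ (sym (*-identityʳ _))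
  expMinusConst≋Eλ (suc m) = sym (trans (+-cong (trans (*-identityˡ _) (1^ m)) (zeroʳ _)) (+-identityʳ _))

  Sλ : Series
  Sλ = FEF.scaleS (1# - λ') (FEF.egfInv (FEF.expMinusConst λ'))

  Sλ⊛Eλ : Sλ ⊛ Eλ ≋ const (1# - λ')
  Sλ⊛Eλ m = trans (scale-⊛ (1# - λ') U Eλ m) (*-congˡ (begin
    (U ⊛ Eλ) m                    ≈⟨ ⊛-comm U Eλ m ⟩
    (Eλ ⊛ U) m                    ≈⟨ ⊛-congˡ U (λ k → sym (expMinusConst≋Eλ k)) m ⟩
    (FEF.expMinusConst λ' ⊛ U) m  ≈⟨ egfInv-inverse (FEF.expMinusConst λ') 1-λ≉0 m ⟩
    1ₛ m                          ∎))
    where U = FEF.egfInv (FEF.expMinusConst λ')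

  H≈coeff : ∀ m N z → FEF.H m N z λ' ≈ (Sλ 𝕊.^ N ⊛ expₛ z) m
  H≈coeff m N z = trans (egfMul≋⊛ (FEF.egfPow Sλ N) (FEF.expS z) m)
                        (⊛-cong (egfPow≋^ Sλ N) (^≈^ z) m)

  binomial-term : ∀ x k j l → expₛ x ⊛ (𝕊.ι k ⊛ (eᵗ 𝕊.^ l ⊛ const (- λ') 𝕊.^ j))
                                ≋ scale (ι k * (- λ') ^ j) (expₛ (x + ι l))
  binomial-term x k j l m = begin
    (expₛ x ⊛ (𝕊.ι k ⊛ (El ⊛ Kj))) m
      ≈⟨ solveₛ 4 (λ X I El Kj → (X ⊗ (I ⊗ (El ⊗ Kj))) ≔ (I ⊗ (Kj ⊗ (X ⊗ El)))) (λ _ → refl) (expₛ x) (𝕊.ι k) El Kj m ⟩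
    (𝕊.ι k ⊛ (Kj ⊛ (expₛ x ⊛ El))) m
      ≈⟨ 𝕊ι-⊛ k (Kj ⊛ (expₛ x ⊛ El)) m ⟩
    ι k * (Kj ⊛ (expₛ x ⊛ El)) m
      ≈⟨ *-congˡ (trans (⊛-congˡ (expₛ x ⊛ El) (const-^ (- λ') j) m) (const-⊛ ((- λ') ^ j) (expₛ x ⊛ El) m)) ⟩
    ι k * ((- λ') ^ j * (expₛ x ⊛ El) m)
      ≈⟨ *-congˡ (*-congˡ (trans (⊛-congʳ (expₛ x) (eᵗ-^ l) m) (expₛ-⊛ x (ι l) m))) ⟩
    ι k * ((- λ') ^ j * (x + ι l) ^ m)
      ≈⟨ sym (*-assoc _ _ _) ⟩
    (ι k * (- λ') ^ j) * (x + ι l) ^ m ∎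
    where El = eᵗ 𝕊.^ l
          Kj = const (- λ') 𝕊.^ j

  binomial-sum : ∀ x N A m →
    Σ N (λ l → ι (N C l) * ((- λ') ^ (N ∸ l) * (A ⊛ expₛ (x + ι l)) m)) ≈ (A ⊛ (expₛ x ⊛ Eλ 𝕊.^ N)) m
  binomial-sum x N A m = begin
    Σ N (λ l → ι (N C l) * ((- λ') ^ (N ∸ l) * (A ⊛ expₛ (x + ι l)) m))
      ≈⟨ Σ-cong′ N (λ l → trans (sym (*-assoc _ _ _)) (sym (⊛-scale _ A (expₛ (x + ι l)) m))) ⟩
    Σ N (λ l → (A ⊛ Fs l) m)    ≈⟨ sym (Σ-coeff N (λ l → A ⊛ Fs l) m) ⟩
    𝕊.Σ N (λ l → A ⊛ Fs l) m    ≈⟨ sym (𝕊.Σ-*ˡ N A Fs m) ⟩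
    (A ⊛ 𝕊.Σ N Fs) m            ≈⟨ ⊛-congʳ A expansion m ⟩
    (A ⊛ (expₛ x ⊛ Eλ 𝕊.^ N)) m ∎
    where
    Fs = λ l → scale (ι (N C l) * (- λ') ^ (N ∸ l)) (expₛ (x + ι l))
    expansion : 𝕊.Σ N Fs ≋ expₛ x ⊛ Eλ 𝕊.^ N
    expansion = 𝕊.sym (𝕊.trans (⊛-congʳ (expₛ x) (𝕊.binomial N eᵗ (const (- λ'))))
                  (𝕊.trans (𝕊.Σ-*ˡ N (expₛ x) _) (𝕊.Σ-cong′ N (λ l → binomial-term x (N C l) (N ∸ l) l))))

  Sλ^N-cancels : ∀ x N → Sλ 𝕊.^ N ⊛ (expₛ x ⊛ Eλ 𝕊.^ N) ≋ scale ((1# - λ') ^ N) (expₛ x)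
  Sλ^N-cancels x N = 𝕊.begin
    Sλ 𝕊.^ N ⊛ (expₛ x ⊛ Eλ 𝕊.^ N)
      𝕊.≈⟨ solveₛ 3 (λ A X B → (A ⊗ (X ⊗ B)) ≔ ((A ⊗ B) ⊗ X)) (λ _ → refl) (Sλ 𝕊.^ N) (expₛ x) (Eλ 𝕊.^ N) ⟩
    (Sλ 𝕊.^ N ⊛ Eλ 𝕊.^ N) ⊛ expₛ x
      𝕊.≈⟨ ⊛-congˡ (expₛ x) (𝕊.sym (𝕊.^-distrib-* Sλ Eλ N)) ⟩
    (Sλ ⊛ Eλ) 𝕊.^ N ⊛ expₛ x
      𝕊.≈⟨ ⊛-congˡ (expₛ x) (𝕊.trans (𝕊.^-congˡ N Sλ⊛Eλ) (const-^ (1# - λ') N)) ⟩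
    const ((1# - λ') ^ N) ⊛ expₛ x
      𝕊.≈⟨ const-⊛ ((1# - λ') ^ N) (expₛ x) ⟩
    scale ((1# - λ') ^ N) (expₛ x) 𝕊.∎

  lhs≈x^m : ∀ x m N →
    ((1# - λ') ⁻¹) FEF.^ N * FEF.Σ≤ N (λ l → ι (N C l) * ((- λ') FEF.^ (N ∸ l) * FEF.H m N (x + ι l) λ'))
      ≈ x ^ m
  lhs≈x^m x m N = begin
    ((1# - λ') ⁻¹) FEF.^ N * FEF.Σ≤ N (λ l → ι (N C l) * ((- λ') FEF.^ (N ∸ l) * FEF.H m N (x + ι l) λ'))
      ≈⟨ *-cong (^≈^ _ N) (Σ≤≈Σ N (λ l → *-congˡ (*-cong (^≈^ (- λ') (N ∸ l)) (H≈coeff m N (x + ι l))))) ⟩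
    ((1# - λ') ⁻¹) ^ N * Σ N (λ l → ι (N C l) * ((- λ') ^ (N ∸ l) * (Sλ 𝕊.^ N ⊛ expₛ (x + ι l)) m))
      ≈⟨ *-congˡ (trans (binomial-sum x N (Sλ 𝕊.^ N) m) (Sλ^N-cancels x N m)) ⟩
    ((1# - λ') ⁻¹) ^ N * ((1# - λ') ^ N * x ^ m)
      ≈⟨ sym (*-assoc _ _ _) ⟩
    (((1# - λ') ⁻¹) ^ N * (1# - λ') ^ N) * x ^ m
      ≈⟨ *-congʳ (trans (sym (^-distrib-* _ _ N)) (trans (^-congˡ N (⁻¹-inverseˡ 1-λ≉0)) (1^ N))) ⟩
    1# * x ^ m
      ≈⟨ *-identityˡ _ ⟩
    x ^ m ∎

module FallingFactorials {c ℓ} (F : CharZeroField c ℓ) where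
  open FieldFacts F
  open import Algebra.Properties.Group +-group using (∙-cancelˡ)
  open import Algebra.Properties.Ring ring using (-0#≈0#)

  τ : Series
  τ k = ι (suc k) ⁻¹

  τ₀≈1 : τ 0 ≈ 1#
  τ₀≈1 = trans (sym (*-identityʳ _)) (trans (*-congˡ (sym (+-identityʳ 1#))) (⁻¹-inverseˡ (ι-nonzero 1)))

  β : Series
  β = FEF.egfInv τ

  τβ≋1 : τ ⊛ β ≋ 1ₛ
  τβ≋1 = egfInv-inverse τ (⁻¹-nonzero (ι-nonzero 1))

  β₀≈1 : β 0 ≈ 1#
  β₀≈1 = begin
    β 0          ≈⟨ sym (trans (*-congʳ τ₀≈1) (*-identityˡ _)) ⟩
    τ 0 * β 0    ≈⟨ sym (⊛-coeff₀ τ β) ⟩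
    (τ ⊛ β) 0    ≈⟨ τβ≋1 0 ⟩
    1#           ∎

  tτ⊞1≋eᵗ : tₛ ⊛ τ ⊞ 1ₛ ≋ eᵗ
  tτ⊞1≋eᵗ zero = trans (+-congʳ (t-coeff₀ τ)) (+-identityˡ _)
  tτ⊞1≋eᵗ (suc k) = trans (+-identityʳ _)
    (trans (t-coeffₛ k τ) (trans (⁻¹-inverse _ (ι-nonzero (suc k))) (sym (1^ (suc k)))))

  -- differentiating t τ = e^t - 1:  t τ' + τ = e^t
  tDτ⊞τ≋eᵗ : tₛ ⊛ D τ ⊞ τ ≋ eᵗ
  tDτ⊞τ≋eᵗ m = begin
    (tₛ ⊛ D τ) m + τ m              ≈⟨ +-comm _ _ ⟩
    τ m + (tₛ ⊛ D τ) m              ≈⟨ +-congʳ (sym (trans (⊛-congˡ τ Dt≋1 m) (⊛-identityˡ τ m))) ⟩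
    (D tₛ ⊛ τ) m + (tₛ ⊛ D τ) m     ≈⟨ sym (leibniz tₛ τ m) ⟩
    (tₛ ⊛ τ) (suc m)                ≈⟨ sym (+-identityʳ _) ⟩
    (tₛ ⊛ τ ⊞ 1ₛ) (suc m)           ≈⟨ tτ⊞1≋eᵗ (suc m) ⟩
    eᵗ (suc m)                      ≈⟨ *-identityˡ _ ⟩
    eᵗ m                            ∎

  -- differentiating τ β = 1
  Dτβ≋0 : D τ ⊛ β ⊞ τ ⊛ D β ≋ 0ₛ
  Dτβ≋0 m = trans (sym (leibniz τ β m)) (τβ≋1 (suc m))

  β-ode : tₛ ⊛ D β ⊞ eᵗ ⊛ (β ⊛ β) ≋ β
  β-ode = 𝕊.begin
    tₛ ⊛ D β ⊞ eᵗ ⊛ (β ⊛ β)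
      𝕊.≈⟨ 𝕊.+-congˡ (⊛-congˡ (β ⊛ β) (𝕊.sym tDτ⊞τ≋eᵗ)) ⟩
    tₛ ⊛ D β ⊞ (tₛ ⊛ D τ ⊞ τ) ⊛ (β ⊛ β)
      𝕊.≈⟨ solveₛ 5 (λ t db dt b u → ((t ⊗ db) ⊕ (((t ⊗ dt) ⊕ u) ⊗ (b ⊗ b)))
                       ≔ (((t ⊗ db) ⊗ conₛ 1) ⊕ (((t ⊗ dt) ⊗ (b ⊗ b)) ⊕ (u ⊗ (b ⊗ b)))))
                    (λ _ → refl) tₛ (D β) (D τ) β τ ⟩
    (tₛ ⊛ D β) ⊛ 1ₛ ⊞ ((tₛ ⊛ D τ) ⊛ (β ⊛ β) ⊞ τ ⊛ (β ⊛ β))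
      𝕊.≈⟨ 𝕊.+-congʳ (𝕊.*-congˡ (𝕊.sym τβ≋1)) ⟩
    (tₛ ⊛ D β) ⊛ (τ ⊛ β) ⊞ ((tₛ ⊛ D τ) ⊛ (β ⊛ β) ⊞ τ ⊛ (β ⊛ β))
      𝕊.≈⟨ solveₛ 5 (λ t db dt b u → (((t ⊗ db) ⊗ (u ⊗ b)) ⊕ (((t ⊗ dt) ⊗ (b ⊗ b)) ⊕ (u ⊗ (b ⊗ b))))
                       ≔ (((b ⊗ t) ⊗ ((dt ⊗ b) ⊕ (u ⊗ db))) ⊕ ((u ⊗ b) ⊗ b)))
                    (λ _ → refl) tₛ (D β) (D τ) β τ ⟩
    (β ⊛ tₛ) ⊛ (D τ ⊛ β ⊞ τ ⊛ D β) ⊞ (τ ⊛ β) ⊛ β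
      𝕊.≈⟨ 𝕊.+-cong (𝕊.*-congˡ Dτβ≋0) (⊛-congˡ β τβ≋1) ⟩
    (β ⊛ tₛ) ⊛ 0ₛ ⊞ 1ₛ ⊛ β
      𝕊.≈⟨ 𝕊.trans (𝕊.+-cong (𝕊.zeroʳ _) (𝕊.*-identityˡ _)) (𝕊.+-identityˡ _) ⟩
    β 𝕊.∎

  β^-ode : ∀ n → tₛ ⊛ D (β 𝕊.^ n) ⊞ 𝕊.ι n ⊛ (eᵗ ⊛ β 𝕊.^ suc n) ≋ 𝕊.ι n ⊛ β 𝕊.^ n
  β^-ode zero = 𝕊.trans (𝕊.+-cong (𝕊.zeroʳ tₛ) (𝕊.zeroˡ (eᵗ ⊛ β 𝕊.^ 1))) (𝕊.trans (𝕊.+-identityˡ 0ₛ) (𝕊.sym (𝕊.zeroˡ 1ₛ)))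
  β^-ode (suc n) = 𝕊.begin
    tₛ ⊛ D (β ⊛ B) ⊞ (1ₛ ⊞ 𝕊.ι n) ⊛ (eᵗ ⊛ (β ⊛ (β ⊛ B)))
      𝕊.≈⟨ 𝕊.+-congʳ (⊛-congʳ tₛ (leibniz β B)) ⟩
    tₛ ⊛ (D β ⊛ B ⊞ β ⊛ D B) ⊞ (1ₛ ⊞ 𝕊.ι n) ⊛ (eᵗ ⊛ (β ⊛ (β ⊛ B)))
      𝕊.≈⟨ solveₛ 7 (λ t db b bb dbb ee i → ((t ⊗ ((db ⊗ bb) ⊕ (b ⊗ dbb))) ⊕ ((conₛ 1 ⊕ i) ⊗ (ee ⊗ (b ⊗ (b ⊗ bb)))))
                       ≔ ((((t ⊗ db) ⊕ (ee ⊗ (b ⊗ b))) ⊗ bb) ⊕ (b ⊗ ((t ⊗ dbb) ⊕ (i ⊗ (ee ⊗ (b ⊗ bb)))))))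
                    (λ _ → refl) tₛ (D β) β B (D B) eᵗ (𝕊.ι n) ⟩
    (tₛ ⊛ D β ⊞ eᵗ ⊛ (β ⊛ β)) ⊛ B ⊞ β ⊛ (tₛ ⊛ D B ⊞ 𝕊.ι n ⊛ (eᵗ ⊛ (β ⊛ B)))
      𝕊.≈⟨ 𝕊.+-cong (⊛-congˡ B β-ode) (⊛-congʳ β (β^-ode n)) ⟩
    β ⊛ B ⊞ β ⊛ (𝕊.ι n ⊛ B)
      𝕊.≈⟨ solveₛ 3 (λ b bb i → ((b ⊗ bb) ⊕ (b ⊗ (i ⊗ bb))) ≔ ((conₛ 1 ⊕ i) ⊗ (b ⊗ bb))) (λ _ → refl) β B (𝕊.ι n) ⟩
    (1ₛ ⊞ 𝕊.ι n) ⊛ (β ⊛ B) 𝕊.∎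
    where B = β 𝕊.^ n

  eᵗβ≋t⊞β : eᵗ ⊛ β ≋ tₛ ⊞ β
  eᵗβ≋t⊞β = 𝕊.begin
    eᵗ ⊛ β                 𝕊.≈⟨ ⊛-congˡ β (𝕊.sym tτ⊞1≋eᵗ) ⟩
    (tₛ ⊛ τ ⊞ 1ₛ) ⊛ β      𝕊.≈⟨ solveₛ 3 (λ t u b → (((t ⊗ u) ⊕ conₛ 1) ⊗ b) ≔ ((t ⊗ (u ⊗ b)) ⊕ b)) (λ _ → refl) tₛ τ β ⟩
    tₛ ⊛ (τ ⊛ β) ⊞ β       𝕊.≈⟨ 𝕊.+-congʳ (𝕊.trans (⊛-congʳ tₛ τβ≋1) (𝕊.*-identityʳ tₛ)) ⟩
    tₛ ⊞ β                 𝕊.∎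

  -- ρ n = e^t β^n, the generating function of the Nörlund polynomials B^(n)_m(1)
  ρ : ℕ → Series
  ρ n = eᵗ ⊛ β 𝕊.^ n

  ρ-split : ∀ j φ → ρ (suc j) ⊛ φ ≋ β 𝕊.^ suc j ⊛ φ ⊞ tₛ ⊛ (β 𝕊.^ j ⊛ φ)
  ρ-split j φ = 𝕊.begin
    (eᵗ ⊛ (β ⊛ B)) ⊛ φ       𝕊.≈⟨ solveₛ 4 (λ ee b bb f → ((ee ⊗ (b ⊗ bb)) ⊗ f) ≔ (((ee ⊗ b) ⊗ bb) ⊗ f)) (λ _ → refl) eᵗ β B φ ⟩
    ((eᵗ ⊛ β) ⊛ B) ⊛ φ       𝕊.≈⟨ ⊛-congˡ φ (⊛-congˡ B eᵗβ≋t⊞β) ⟩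
    ((tₛ ⊞ β) ⊛ B) ⊛ φ       𝕊.≈⟨ solveₛ 4 (λ t b bb f → (((t ⊕ b) ⊗ bb) ⊗ f) ≔ (((b ⊗ bb) ⊗ f) ⊕ (t ⊗ (bb ⊗ f)))) (λ _ → refl) tₛ β B φ ⟩
    (β ⊛ B) ⊛ φ ⊞ tₛ ⊛ (B ⊛ φ) 𝕊.∎
    where B = β 𝕊.^ j

  -- The top coefficient of ρ(n+1) φ only sees the derivative of φ:
  --   (ρ(n+1) φ)_n = (β^n φ')_(n-1)      for n = k+1.
  -- Multiplying by n, this is the (k+1)-st coefficient of β^-ode times φ.
  ρ-top-coeff : ∀ k φ → (ρ (suc (suc k)) ⊛ φ) (suc k) ≈ (β 𝕊.^ suc k ⊛ D φ) k
  ρ-top-coeff k φ = *-cancelˡ (ι-nonzero n) (∙-cancelˡ (ι n * W (suc k)) _ _ (begin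
      ι n * W (suc k) + ι n * (ρ (suc n) ⊛ φ) (suc k)
        ≈⟨ +-cong (sym (trans (⊛-congʳ tₛ (λ j → sym (leibniz B φ j)) (suc k)) (t-coeffₛ k (D W))))
                  (sym (𝕊ι-⊛ n (ρ (suc n) ⊛ φ) (suc k))) ⟩
      (tₛ ⊛ (D B ⊛ φ ⊞ B ⊛ D φ)) (suc k) + (𝕊.ι n ⊛ (ρ (suc n) ⊛ φ)) (suc k)
        ≈⟨ multiplied-ode (suc k) ⟩
      (𝕊.ι n ⊛ W) (suc k) + (tₛ ⊛ (B ⊛ D φ)) (suc k)
        ≈⟨ +-cong (𝕊ι-⊛ n W (suc k)) (t-coeffₛ k (B ⊛ D φ)) ⟩
      ι n * W (suc k) + ι n * (B ⊛ D φ) k ∎))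
    where
    n = suc k
    B = β 𝕊.^ n
    W = B ⊛ φ
    multiplied-ode : tₛ ⊛ (D B ⊛ φ ⊞ B ⊛ D φ) ⊞ 𝕊.ι n ⊛ (ρ (suc n) ⊛ φ) ≋ 𝕊.ι n ⊛ W ⊞ tₛ ⊛ (B ⊛ D φ)
    multiplied-ode = 𝕊.begin
      tₛ ⊛ (D B ⊛ φ ⊞ B ⊛ D φ) ⊞ 𝕊.ι n ⊛ (ρ (suc n) ⊛ φ)
        𝕊.≈⟨ solveₛ 7 (λ t dbb f bb df i eb → ((t ⊗ ((dbb ⊗ f) ⊕ (bb ⊗ df))) ⊕ (i ⊗ (eb ⊗ f)))
                         ≔ ((((t ⊗ dbb) ⊕ (i ⊗ eb)) ⊗ f) ⊕ (t ⊗ (bb ⊗ df))))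
                      (λ _ → refl) tₛ (D B) φ B (D φ) (𝕊.ι n) (ρ (suc n)) ⟩
      (tₛ ⊛ D B ⊞ 𝕊.ι n ⊛ ρ (suc n)) ⊛ φ ⊞ tₛ ⊛ (B ⊛ D φ)
        𝕊.≈⟨ 𝕊.+-congʳ (⊛-congˡ φ (β^-ode n)) ⟩
      (𝕊.ι n ⊛ B) ⊛ φ ⊞ tₛ ⊛ (B ⊛ D φ)
        𝕊.≈⟨ 𝕊.+-congʳ (𝕊.*-assoc (𝕊.ι n) B φ) ⟩
      𝕊.ι n ⊛ W ⊞ tₛ ⊛ (B ⊛ D φ) 𝕊.∎

  S₁ : ℕ → ℕ → Carrier
  S₁ = FEF.S₁

  S₁-vanishes : ∀ m l → m < l → S₁ m l ≈ 0#
  S₁-vanishes zero (suc l) _ = refl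
  S₁-vanishes (suc m) (suc l) (s≤s m<l) =
    trans (+-cong (S₁-vanishes m l m<l) (trans (*-congˡ (S₁-vanishes m (suc l) (ℕP.m<n⇒m<1+n m<l))) (zeroʳ _)))
          (+-identityʳ _)

  -- S₁(m+1,l) = S₁(m,l-1) - m S₁(m,l), read as an identity of functionals:
  --   Σ_l S₁(m+1,l) ψ_l = Σ_l S₁(m,l) (ψ_(l+1) - m ψ_l)
  Σ-S₁-step : ∀ m (ψ : Series) →
    Σ (suc m) (λ l → S₁ (suc m) l * ψ l) ≈ Σ m (λ l → S₁ m l * (ψ (suc l) + (- ι m) * ψ l))
  Σ-S₁-step m ψ = begin
    Σ (suc m) (λ l → S₁ (suc m) l * ψ l)
      ≈⟨ Σ-head m _ ⟩
    (κ * S₁ m 0) * ψ 0 + Σ m (λ l → (S₁ m l + κ * S₁ m (suc l)) * ψ (suc l))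
      ≈⟨ +-congˡ (trans (Σ-cong′ m (λ l → trans (distribʳ _ _ _) (+-congˡ (*-assoc _ _ _))))
                        (trans (Σ-+ m _ _) (+-congˡ (sym (Σ-*ˡ m κ _))))) ⟩
    (κ * S₁ m 0) * ψ 0 + (A + κ * Y)
      ≈⟨ solve 5 (λ κ s p a y → (((κ :* s) :* p) :+ (a :+ (κ :* y))) := (a :+ (κ :* ((s :* p) :+ y))))
               refl κ (S₁ m 0) (ψ 0) A Y ⟩
    A + κ * (S₁ m 0 * ψ 0 + Y)
      ≈⟨ +-congˡ (*-congˡ (sym shifted)) ⟩
    A + κ * Σ m (λ l → S₁ m l * ψ l)
      ≈⟨ trans (+-congˡ (Σ-*ˡ m κ _)) (sym (Σ-+ m _ _)) ⟩
    Σ m (λ l → S₁ m l * ψ (suc l) + κ * (S₁ m l * ψ l))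
      ≈⟨ Σ-cong′ m (λ l → solve 4 (λ s p q κ → ((s :* p) :+ (κ :* (s :* q))) := (s :* (p :+ (κ :* q))))
                                  refl (S₁ m l) (ψ (suc l)) (ψ l) κ) ⟩
    Σ m (λ l → S₁ m l * (ψ (suc l) + κ * ψ l)) ∎
    where
    κ = - ι m
    A = Σ m (λ l → S₁ m l * ψ (suc l))
    Y = Σ m (λ l → S₁ m (suc l) * ψ (suc l))
    -- the term l = m+1 of the re-indexed sum vanishes
    shifted : Σ m (λ l → S₁ m l * ψ l) ≈ S₁ m 0 * ψ 0 + Y
    shifted = begin
      Σ m (λ l → S₁ m l * ψ l)                   ≈⟨ sym (+-identityʳ _) ⟩
      Σ m (λ l → S₁ m l * ψ l) + 0#              ≈⟨ +-congˡ (sym (trans (*-congʳ (S₁-vanishes m (suc m) (ℕP.n<1+n m))) (zeroˡ _))) ⟩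
      Σ (suc m) (λ l → S₁ m l * ψ l)             ≈⟨ Σ-head m (λ l → S₁ m l * ψ l) ⟩
      S₁ m 0 * ψ 0 + Y                           ∎

  -- The main identity: Σ_l S₁(m,l) ψ_l = (e^t β^(m+1) ψ)_m.  Both sides satisfy
  -- the recurrence of Σ-S₁-step; for the right side this is ρ-split together
  -- with ρ-top-coeff.
  falling-functional : ∀ m ψ → Σ m (λ l → S₁ m l * ψ l) ≈ (ρ (suc m) ⊛ ψ) m
  falling-functional zero ψ = sym (begin
    (ρ 1 ⊛ ψ) 0                            ≈⟨ ρ-split 0 ψ 0 ⟩
    (β 𝕊.^ 1 ⊛ ψ) 0 + (tₛ ⊛ (1ₛ ⊛ ψ)) 0     ≈⟨ +-cong (⊛-coeff₀ (β 𝕊.^ 1) ψ) (t-coeff₀ (1ₛ ⊛ ψ)) ⟩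
    (β ⊛ 1ₛ) 0 * ψ 0 + 0#                  ≈⟨ +-identityʳ _ ⟩
    (β ⊛ 1ₛ) 0 * ψ 0                       ≈⟨ *-congʳ (trans (⊛-identityʳ β 0) β₀≈1) ⟩
    1# * ψ 0                               ∎)
  falling-functional (suc m) ψ = begin
    Σ (suc m) (λ l → S₁ (suc m) l * ψ l)
      ≈⟨ Σ-S₁-step m ψ ⟩
    Σ m (λ l → S₁ m l * φ l)
      ≈⟨ falling-functional m φ ⟩
    (ρ (suc m) ⊛ φ) m
      ≈⟨ trans (⊛-distribˡ (ρ (suc m)) (D ψ) (scale κ ψ) m) (+-congˡ (⊛-scale κ (ρ (suc m)) ψ m)) ⟩
    (ρ (suc m) ⊛ D ψ) m + κ * (ρ (suc m) ⊛ ψ) m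
      ≈⟨ +-congʳ (ρ-split m (D ψ) m) ⟩
    ((β 𝕊.^ suc m ⊛ D ψ) m + (tₛ ⊛ (β 𝕊.^ m ⊛ D ψ)) m) + κ * (ρ (suc m) ⊛ ψ) m
      ≈⟨ trans (+-assoc _ _ _) (+-congˡ (lower-terms-cancel m)) ⟩
    (β 𝕊.^ suc m ⊛ D ψ) m + 0#
      ≈⟨ +-identityʳ _ ⟩
    (β 𝕊.^ suc m ⊛ D ψ) m
      ≈⟨ sym (ρ-top-coeff m ψ) ⟩
    (ρ (suc (suc m)) ⊛ ψ) (suc m) ∎
    where
    κ = - ι m
    φ = D ψ ⊞ scale κ ψ
    lower-terms-cancel : ∀ m → (tₛ ⊛ (β 𝕊.^ m ⊛ D ψ)) m + (- ι m) * (ρ (suc m) ⊛ ψ) m ≈ 0#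
    lower-terms-cancel zero =
      trans (+-cong (t-coeff₀ (β 𝕊.^ 0 ⊛ D ψ)) (trans (*-congʳ -0#≈0#) (zeroˡ _))) (+-identityˡ _)
    lower-terms-cancel (suc k) = begin
      (tₛ ⊛ (β 𝕊.^ suc k ⊛ D ψ)) (suc k) + (- ι (suc k)) * Z
        ≈⟨ +-congʳ (trans (t-coeffₛ k (β 𝕊.^ suc k ⊛ D ψ)) (*-congˡ (sym (ρ-top-coeff k ψ)))) ⟩
      ι (suc k) * Z + (- ι (suc k)) * Z
        ≈⟨ sym (distribʳ _ _ _) ⟩
      (ι (suc k) - ι (suc k)) * Z
        ≈⟨ trans (*-congʳ (-‿inverseʳ _)) (zeroˡ _) ⟩
      0# ∎
      where Z = (ρ (suc (suc k)) ⊛ ψ) (suc k)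

-- The right-hand side.  S₂(k+n,n)/C(k+n,n) is the k-th coefficient of τ^n, and
-- the double sum collapses to x^m by falling-functional.
module RightSide {c ℓ} (F : CharZeroField c ℓ) where
  open FieldFacts F
  open FallingFactorials F

  t^-coeff : ∀ n k (Y : Series) → ι (k !) * (tₛ 𝕊.^ n ⊛ Y) (k +ℕ n) ≈ ι ((k +ℕ n) !) * Y k
  t^-coeff zero k Y = trans (*-congˡ (trans (⊛-identityˡ Y (k +ℕ 0)) (reflexive (P.cong Y (ℕP.+-identityʳ k)))))
                            (*-congʳ (reflexive (P.cong (λ z → ι (z !)) (P.sym (ℕP.+-identityʳ k)))))
  t^-coeff (suc n) k Y = begin
    ι (k !) * ((tₛ ⊛ tₛ 𝕊.^ n) ⊛ Y) (k +ℕ suc n)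
      ≈⟨ *-congˡ (reflexive (P.cong ((tₛ ⊛ tₛ 𝕊.^ n) ⊛ Y) (ℕP.+-suc k n))) ⟩
    ι (k !) * ((tₛ ⊛ tₛ 𝕊.^ n) ⊛ Y) (suc (k +ℕ n))
      ≈⟨ *-congˡ (trans (⊛-assoc tₛ (tₛ 𝕊.^ n) Y (suc (k +ℕ n))) (t-coeffₛ (k +ℕ n) (tₛ 𝕊.^ n ⊛ Y))) ⟩
    ι (k !) * (ι (suc (k +ℕ n)) * (tₛ 𝕊.^ n ⊛ Y) (k +ℕ n))
      ≈⟨ solve 3 (λ a b z → (a :* (b :* z)) := (b :* (a :* z))) refl (ι (k !)) _ _ ⟩
    ι (suc (k +ℕ n)) * (ι (k !) * (tₛ 𝕊.^ n ⊛ Y) (k +ℕ n))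
      ≈⟨ *-congˡ (t^-coeff n k Y) ⟩
    ι (suc (k +ℕ n)) * (ι ((k +ℕ n) !) * Y k)
      ≈⟨ trans (sym (*-assoc _ _ _)) (*-congʳ (sym (ι-* (suc (k +ℕ n)) ((k +ℕ n) !)))) ⟩
    ι (suc (k +ℕ n) !) * Y k
      ≈⟨ *-congʳ (reflexive (P.cong (λ z → ι (z !)) (P.sym (ℕP.+-suc k n)))) ⟩
    ι ((k +ℕ suc n) !) * Y k ∎

  eᵗ-1≋tτ : FEF.expMinusConst 1# ≋ tₛ ⊛ τ
  eᵗ-1≋tτ zero = trans (-‿inverseʳ 1#) (sym (t-coeff₀ τ))
  eᵗ-1≋tτ (suc k) = sym (trans (t-coeffₛ k τ) (⁻¹-inverse _ (ι-nonzero (suc k))))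

  -- Since (e^t-1)^n = t^n τ^n, comparing the (k+n)-th coefficients gives
  -- n! S₂(k+n,n) = ((k+n)!/k!) (τ^n)_k.
  S₂-quotient≈τ^n : ∀ n k → (ι ((k +ℕ n) C n)) ⁻¹ * FEF.S₂ (k +ℕ n) n ≈ (τ 𝕊.^ n) k
  S₂-quotient≈τ^n n k = sym (*-cancelˡ q≉0 (begin
    q * (τ 𝕊.^ n) k                        ≈⟨ *-congʳ (sym [k+n]!≈q) ⟩
    ι ((k +ℕ n) !) * (τ 𝕊.^ n) k           ≈⟨ sym (t^-coeff n k (τ 𝕊.^ n)) ⟩
    ι (k !) * (tₛ 𝕊.^ n ⊛ τ 𝕊.^ n) (k +ℕ n) ≈⟨ *-congˡ (sym Z≈) ⟩
    ι (k !) * Z                            ≈⟨ sym (trans rearrange (trans (*-congʳ inverses) (*-identityˡ _))) ⟩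
    q * (ιC ⁻¹ * (ιn ⁻¹ * Z))              ∎))
    where
    ιC = ι ((k +ℕ n) C n)
    ιn = ι (n !)
    q = ιC * ιn * ι (k !)
    Z = FEF.egfPow (FEF.expMinusConst 1#) n (k +ℕ n)
    [k+n]!≈q : ι ((k +ℕ n) !) ≈ q
    [k+n]!≈q = trans (reflexive (P.cong ι (P.sym (C[k+n,n]*n!*k!≡[k+n]! k n))))
                     (trans (ι-* (((k +ℕ n) C n) *ℕ n !) (k !)) (*-congʳ (ι-* ((k +ℕ n) C n) (n !))))
    q≉0 : ¬ q ≈ 0#
    q≉0 q≈0 = ι-nonzero ((k +ℕ n) !) {{(k +ℕ n) !≢0}} (trans [k+n]!≈q q≈0)
    ιC≉0 : ¬ ιC ≈ 0#
    ιC≉0 ιC≈0 = q≉0 (trans (*-congʳ (trans (*-congʳ ιC≈0) (zeroˡ _))) (zeroˡ _))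
    inverses : (ιC * ιC ⁻¹) * (ιn * ιn ⁻¹) ≈ 1#
    inverses = trans (*-cong (⁻¹-inverse ιC ιC≉0) (⁻¹-inverse ιn (ι-nonzero (n !) {{n !≢0}}))) (*-identityˡ 1#)
    rearrange : q * (ιC ⁻¹ * (ιn ⁻¹ * Z)) ≈ ((ιC * ιC ⁻¹) * (ιn * ιn ⁻¹)) * (ι (k !) * Z)
    rearrange = solve 6 (λ a b d ai bi z → (((a :* b) :* d) :* (ai :* (bi :* z))) := (((a :* ai) :* (b :* bi)) :* (d :* z)))
                        refl ιC ιn (ι (k !)) (ιC ⁻¹) (ιn ⁻¹) Z
    Z≈ : Z ≈ (tₛ 𝕊.^ n ⊛ τ 𝕊.^ n) (k +ℕ n)
    Z≈ = trans (egfPow≋^ _ n (k +ℕ n)) (trans (𝕊.^-congˡ n eᵗ-1≋tτ (k +ℕ n)) (𝕊.^-distrib-* tₛ τ n (k +ℕ n)))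

  rhs≈x^m : ∀ x m →
    FEF.Σ≤ m (λ l → FEF.Σ≤ l (λ k → ι (l C k) * ((ι ((k +ℕ suc m) C suc m)) ⁻¹
        * (S₁ m l * (FEF.S₂ (k +ℕ suc m) (suc m) * ((x - 1#) FEF.^ (l ∸ k)))))))
      ≈ x ^ m
  rhs≈x^m x m = begin
    FEF.Σ≤ m (λ l → FEF.Σ≤ l (λ k → ι (l C k) * ((ι ((k +ℕ n) C n)) ⁻¹
        * (S₁ m l * (FEF.S₂ (k +ℕ n) n * (y FEF.^ (l ∸ k)))))))
      ≈⟨ Σ≤≈Σ m (λ l → Σ≤≈Σ l (λ k → trans
            (solve 5 (λ a g s t w → (a :* (g :* (s :* (t :* w)))) := (s :* (a :* ((g :* t) :* w)))) refl (ι (l C k)) _ (S₁ m l) _ _)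
            (*-congˡ (*-congˡ (*-cong (S₂-quotient≈τ^n n k) (^≈^ y (l ∸ k))))))) ⟩
    Σ m (λ l → Σ l (λ k → S₁ m l * (ι (l C k) * ((τ 𝕊.^ n) k * y ^ (l ∸ k)))))
      ≈⟨ Σ-cong′ m (λ l → sym (Σ-*ˡ l (S₁ m l) _)) ⟩
    Σ m (λ l → S₁ m l * (τ 𝕊.^ n ⊛ expₛ y) l)
      ≈⟨ falling-functional m (τ 𝕊.^ n ⊛ expₛ y) ⟩
    (ρ n ⊛ (τ 𝕊.^ n ⊛ expₛ y)) m
      ≈⟨ collapse m ⟩
    (eᵗ ⊛ expₛ y) m
      ≈⟨ expₛ-⊛ 1# y m ⟩
    (1# + (x - 1#)) ^ m
      ≈⟨ ^-congˡ m (trans (+-comm _ _) (trans (+-assoc _ _ _) (trans (+-congˡ (-‿inverseˡ 1#)) (+-identityʳ x)))) ⟩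
    x ^ m ∎
    where
    n = suc m
    y = x - 1#
    -- e^t β^n τ^n e^(yt) = e^t e^(yt), as β τ = 1
    collapse : ρ n ⊛ (τ 𝕊.^ n ⊛ expₛ y) ≋ eᵗ ⊛ expₛ y
    collapse = 𝕊.begin
      (eᵗ ⊛ β 𝕊.^ n) ⊛ (τ 𝕊.^ n ⊛ expₛ y)
        𝕊.≈⟨ solveₛ 4 (λ ee bn tn w → ((ee ⊗ bn) ⊗ (tn ⊗ w)) ≔ (ee ⊗ ((tn ⊗ bn) ⊗ w))) (λ _ → refl) eᵗ (β 𝕊.^ n) (τ 𝕊.^ n) (expₛ y) ⟩
      eᵗ ⊛ ((τ 𝕊.^ n ⊛ β 𝕊.^ n) ⊛ expₛ y)
        𝕊.≈⟨ ⊛-congʳ eᵗ (⊛-congˡ (expₛ y) (𝕊.trans (𝕊.sym (𝕊.^-distrib-* τ β n)) (𝕊.trans (𝕊.^-congˡ n τβ≋1) (𝕊.1^ n)))) ⟩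
      eᵗ ⊛ (1ₛ ⊛ expₛ y)
        𝕊.≈⟨ ⊛-congʳ eᵗ (⊛-identityˡ (expₛ y)) ⟩
      eᵗ ⊛ expₛ y 𝕊.∎

theorem5 : ∀ {c ℓ} (F : CharZeroField c ℓ) →
    let open CharZeroField F
        open FE F
    in (λ' x : Carrier) → ¬ (λ' ≈ 1#) → (n : ℕ) → 1 ≤ n → (a : ℕ) →
       ((1# - λ') ⁻¹) ^ (a *ℕ n)
         * Σ≤ (a *ℕ n) (λ l → ι ((a *ℕ n) C l) * ((- λ') ^ ((a *ℕ n) ∸ l)
                                 * H (n ∸ 1) (a *ℕ n) (x + ι l) λ'))
       ≈ Σ≤ (n ∸ 1) (λ l → Σ≤ l (λ k →
           ι (l C k) * ((ι ((k +ℕ n) C n)) ⁻¹ * (S₁ (n ∸ 1) l * (S₂ (k +ℕ n) n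
             * ((x - 1#) ^ (l ∸ k)))))))
theorem5 F λ' x λ'≉1 (suc m) (s≤s z≤n) a =
  trans (LeftSide.lhs≈x^m F λ' λ'≉1 x m (a *ℕ suc m)) (sym (RightSide.rhs≈x^m F x m))
  where open CharZeroField F using (trans; sym)
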